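{- Let $M=\langle W,\succeq,\mathbb{V}\rangle$ be a limited preference model, $\varphi$ a formula and $rep$ a choice function on nonempty subsets of $W$. Then the block $\mathrm{MaxChain}(M,\varphi)=\mathrm{chain}(\mathrm{MaxSeq}(W,\mathrm{Cond}(\varphi)))$ (iv)-covers every block on $M$.
   Context: Formulas: $x\in\mathit{Var}\mid\neg\psi\mid\psi_1\wedge\psi_2\mid\Box\psi\mid\mathcal{O}(\psi_1\mid\psi_2)$; $\mathrm{Cond}(\varphi)=\{\alpha:\mathcal{O}(\gamma\mid\alpha)\text{ a subformula of }\varphi\}$. A preference model $M=\langle W,\succeq,\mathbb{V}\rangle$: $W$ nonempty, $\succeq$ any binary relation; $w_1\succ w_2$ iff $w_1\succeq w_2$ and not $w_2\succeq w_1$; $\max_\succ(U)=\{v\in U:\neg\exists u\in U,u\succ v\}$; $\mathrm{Bet}(v)=\{w:w\succ v\}$. Truth sets: $\|x\|=\mathbb{V}(x)$, $\|\neg\psi\|=W\setminus\|\psi\|$, $\|\psi_1\wedge\psi_2\|=\|\psi_1\|\cap\|\psi_2\|$, $\|\Box\beta\|=W$ if $\|\beta\|=W$ else $\emptyset$, $\|\mathcal{O}(\gamma\mid\alpha)\|=W$ if $\max_\succ(\|\alpha\|)\subseteq\|\gamma\|$ else $\emptyset$; $M,w\models\psi$ iff $w\in\|\psi\|$. $M$ is limited if for every formula $\alpha$, $\|\alpha\|\neq\emptyset$ implies $\max_\succ(\|\alpha\|)\neq\emptyset$. $\mathrm{SatForm}(M,U)=\{\psi:\exists u\in U,M,u\models\psi\}$.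 $rep$ assigns to each nonempty $S\subseteq W$ an element of $S$. For $U\subseteq W$ and finite set $\mathcal{A}$ of formulas, $D(U,\mathcal{A})=U\cap\max_\succ(\|\bigvee_{\alpha\in\mathcal{A}}\alpha\|)$; $\mathrm{MaxSeq}(U,\mathcal{A})$ is the empty list if $\mathcal{A}=\emptyset$ or $D(U,\mathcal{A})=\emptyset$, and otherwise the list starting with $z=rep(D(U,\mathcal{A}))$ followed by $\mathrm{MaxSeq}(U,\{\alpha\in\mathcal{A}:M,z\not\models\alpha\})$. A block on $M$ is $\langle U,\succeq_U\rangle$ with $U\subseteq W$, $\succeq_U$ a relation on $U$, $W(\langle U,\succeq_U\rangle)=U$; $\mathrm{chain}([w_1,\dots,w_n])=\langle\{w_1,\dots,w_n\},\succeq^{ch}\rangle$ with $w_i\succeq^{ch}w_j$ iff $i\le j$. $B'$ (iv)-covers $B$ (relative to $M,\varphi$) if $\mathrm{SatForm}(M,\mathrm{Bet}(w))\cap\mathrm{Cond}(\varphi)\subseteq\mathrm{SatForm}(M,W(B'))$ for every $w\in W(B)$. -}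

module Defs where

open import Data.List using (List; []; _∷_; _++_; length; filter)
open import Data.List.Membership.Propositional using (_∈_)
open import Data.Nat using (ℕ; zero; suc)
open import Data.Product using (Σ; ∃; _×_; _,_)
open import Relation.Nullary using (¬_; Dec; yes; no)
open import Relation.Binary.PropositionalEquality using (_≡_)
open import Data.Sum using (_⊎_)
open import Data.Empty using (⊥)
open import Data.Unit using (⊤)

data Form (Var : Set) : Set where
  var  : Var → Form Var
  neg  : Form Var → Form Var
  and  : Form Var → Form Var → Form Var
  box  : Form Var → Form Var
  obl  : Form Var → Form Var → Form Var   -- obl γ α  is  O(γ | α)

or : ∀ {Var} → Form Var → Form Var → Form Var
or a b = neg (and (neg a) (neg b))

bigOr : ∀ {Var} → Form Var → List (Form Var) → Form Var
bigOr a []       = a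
bigOr a (b ∷ bs) = or a (bigOr b bs)

Cond : ∀ {Var} → Form Var → List (Form Var)
Cond (var x)   = []
Cond (neg ψ)   = Cond ψ
Cond (and ψ χ) = Cond ψ ++ Cond χ
Cond (box ψ)   = Cond ψ
Cond (obl γ α) = α ∷ (Cond γ ++ Cond α)

-- Preference model  ⟨W, ≽, V⟩ ; subsets of W are predicates W → Set
record Model (Var : Set) : Set₁ where
  field
    W        : Set
    inhabited : W
    _≽_      : W → W → Set
    V        : Var → W → Set

module _ {Var : Set} (M : Model Var) where
  open Model M

  _≻_ : W → W → Set
  w₁ ≻ w₂ = (w₁ ≽ w₂) × ¬ (w₂ ≽ w₁)

  Max : (W → Set) → W → Set
  Max U v = U v × ¬ (∃ λ u → U u × (u ≻ v))

  Bet : W → W → Set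
  Bet v w = w ≻ v

  ⟦_⟧ : Form Var → W → Set
  ⟦ var x ⟧   w = V x w
  ⟦ neg ψ ⟧   w = ¬ (⟦ ψ ⟧ w)
  ⟦ and ψ χ ⟧ w = ⟦ ψ ⟧ w × ⟦ χ ⟧ w
  ⟦ box β ⟧   w = (v : W) → ⟦ β ⟧ v
  ⟦ obl γ α ⟧ w = (v : W) → Max ⟦ α ⟧ v → ⟦ γ ⟧ v

  _⊨_ : W → Form Var → Set
  w ⊨ ψ = ⟦ ψ ⟧ w

  Limited : Set
  Limited = (α : Form Var) → (∃ λ w → ⟦ α ⟧ w) → ∃ λ w → Max ⟦ α ⟧ w

  SatForm : (W → Set) → Form Var → Set
  SatForm U ψ = ∃ λ u → U u × (u ⊨ ψ)

  record Block : Set₁ where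
    field
      U   : W → Set
      ≽U  : (u v : W) → U u → U v → Set

  chain : List W → Block
  chain l = record
    { U  = λ w → w ∈ l
    ; ≽U = λ u v _ _ → ChainLe u v l }
    where
      -- w_i ≽ch w_j iff i ≤ j : some occurrence of u precedes-or-equals some occurrence of v
      ChainLe : W → W → List W → Set
      ChainLe u v []       = ⊥
      ChainLe u v (x ∷ xs) = (u ≡ x × v ∈ (x ∷ xs)) ⊎ ChainLe u v xs

  Covers : Form Var → Block → Block → Set
  Covers φ B' B = (w : W) → Block.U B w → (α : Form Var) →
                  SatForm (Bet w) α → α ∈ Cond φ → SatForm (Block.U B') α

  module _ (em : (P : Set) → Dec P) (rep : (W → Set) → W) where

    D : (W → Set) → Form Var → List (Form Var) → W → Set
    D U a as w = U w × Max ⟦ bigOr a as ⟧ w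

    -- fuel-driven recursion; fuel = length 𝒜 always suffices, since the chosen
    -- z lies in ‖⋁𝒜‖ and hence the filtered list is strictly shorter
    MaxSeqF : ℕ → (W → Set) → List (Form Var) → List W
    MaxSeqF zero    U _        = []
    MaxSeqF (suc n) U []       = []
    MaxSeqF (suc n) U (a ∷ as) with em (∃ (D U a as))
    ... | no  _ = []
    ... | yes _ = z ∷ MaxSeqF n U (filter (λ α → em (¬ (z ⊨ α))) (a ∷ as))
      where z = rep (D U a as)

    MaxSeq : (W → Set) → List (Form Var) → List W
    MaxSeq U 𝒜 = MaxSeqF (length 𝒜) U 𝒜

    MaxChain : Form Var → Block
    MaxChain φ = chain (MaxSeq (λ _ → ⊤) (Cond φ))

{-# OPTIONS --safe #-}
module Submission where

-- A world of MaxSeq is a maximal point of ‖⋁𝒜‖, so it satisfies some condition still in 𝒜, and the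
-- recursion continues on the strictly shorter list of conditions it does not satisfy. Limitedness
-- makes every such maximal set nonempty as long as some remaining condition is satisfiable, hence
-- every satisfiable condition of φ is eventually satisfied by a world of the chain. In particular
-- this holds for every condition satisfied in some Bet(w), whatever the block B.

open import Defs renaming (_⊨_ to _,_⊨_)
open import Data.Empty using (⊥-elim)
open import Data.List using (List; []; _∷_; length; filter)
open import Data.List.Membership.Propositional using (_∈_)
open import Data.List.Membership.Propositional.Properties using (∈-filter⁺)
open import Data.List.Properties using (filter-notAll)
open import Data.List.Relation.Unary.Any as Any using (Any; here; there)
open import Data.Nat using (suc; _≤_; _<_; s≤s)
open import Data.Nat.Properties using (≤-refl; ≤-trans; ≤-pred)
open import Data.Product using (∃; _×_; _,_; proj₁; proj₂)
open import Data.Unit using (⊤; tt)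
open import Function using (_∘_)
open import Relation.Binary.PropositionalEquality using (refl)
open import Relation.Nullary using (Dec; yes; no; ¬_)
open import Relation.Nullary.Decidable using (decidable-stable)

module _ {Var : Set} (M : Model Var) where
  open Model M

  bigOr-intro : ∀ {α u} a as → α ∈ a ∷ as → M , u ⊨ α → M , u ⊨ bigOr a as
  bigOr-intro a []       (here refl) uα = uα
  bigOr-intro a (b ∷ bs) (here refl) uα = λ ¬a×¬⋁bs → proj₁ ¬a×¬⋁bs uα
  bigOr-intro a (b ∷ bs) (there α∈) uα = λ ¬a×¬⋁bs → proj₂ ¬a×¬⋁bs (bigOr-intro b bs α∈ uα)

  bigOr-elim : ∀ {u} a as → M , u ⊨ bigOr a as → ¬ ¬ Any (M , u ⊨_) (a ∷ as)
  bigOr-elim a []       ua       ¬any = ¬any (here ua)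
  bigOr-elim a (b ∷ bs) u⊨a∨⋁bs ¬any =
    u⊨a∨⋁bs ((λ ua → ¬any (here ua)) , λ u⊨⋁bs → bigOr-elim b bs u⊨⋁bs (¬any ∘ there))

  module _ (em : (P : Set) → Dec P) (rep : (W → Set) → W)
           (rep-chooses : (S : W → Set) → ∃ S → S (rep S)) where

    Everywhere : W → Set
    Everywhere _ = ⊤

    fails? : (z : W) (α : Form Var) → Dec (¬ (M , z ⊨ α))
    fails? z α = em (¬ (M , z ⊨ α))

    unsatisfiedBy : W → List (Form Var) → List (Form Var)
    unsatisfiedBy z = filter (fails? z)

    unsatisfiedBy-shrinks : ∀ {z} a as → M , z ⊨ bigOr a as →
                            length (unsatisfiedBy z (a ∷ as)) < length (a ∷ as)
    unsatisfiedBy-shrinks {z} a as z⊨⋁ =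
      filter-notAll (fails? z) (a ∷ as) (Any.map (λ zα ¬zα → ¬zα zα) satisfied)
      where
        satisfied : Any (M , z ⊨_) (a ∷ as)
        satisfied = decidable-stable (em _) (bigOr-elim a as z⊨⋁)

    D-nonempty : Limited M → ∀ {α u} a as → α ∈ a ∷ as → M , u ⊨ α →
                 ∃ (D M em rep Everywhere a as)
    D-nonempty limited a as α∈ uα =
      let (z , z-max) = limited (bigOr a as) (_ , bigOr-intro a as α∈ uα) in z , tt , z-max

    MaxSeqF-complete : Limited M → ∀ n 𝒜 → length 𝒜 ≤ n → ∀ {α u} → α ∈ 𝒜 → M , u ⊨ α →
                       ∃ λ z → z ∈ MaxSeqF M em rep n Everywhere 𝒜 × M , z ⊨ α
    MaxSeqF-complete limited (suc n) (a ∷ as) (s≤s |as|≤n) {α} α∈ uα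
      with em (∃ (D M em rep Everywhere a as))
    ... | no ¬D = ⊥-elim (¬D (D-nonempty limited a as α∈ uα))
    ... | yes D≢∅ with em (M , z ⊨ α)
      where z = rep (D M em rep Everywhere a as)
    ...   | yes zα = _ , here refl , zα
    ...   | no ¬zα =
      let z-max = proj₂ (rep-chooses (D M em rep Everywhere a as) D≢∅)
          shorter = ≤-trans (≤-pred (unsatisfiedBy-shrinks a as (proj₁ z-max))) |as|≤n
          (v , v∈ , vα) = MaxSeqF-complete limited n _ shorter (∈-filter⁺ (fails? _) α∈ ¬zα) uα
      in v , there v∈ , vα

lemma3p15 : {Var : Set} (M : Model Var) → Limited M →
            (em : (P : Set) → Dec P) →
            (rep : (Model.W M → Set) → Model.W M) →
            ((S : Model.W M → Set) → ∃ S → S (rep S)) →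
            (φ : Form Var) (B : Block M) →
            Covers M φ (MaxChain M em rep φ) B
lemma3p15 M limited em rep rep-chooses φ _ _ _ α (u , _ , uα) α∈Condφ =
  MaxSeqF-complete M em rep rep-chooses limited _ (Cond φ) ≤-refl α∈Condφ uα
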